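{- For every closed term $M$ and every value $V$: if $M\to^{*}_{\ell\cup\beta}V$ then $(\widetilde M)~\lambda x\,x\to^{=*}_{a\cup\beta}\Psi(V)$; and if $M\to^{*}_{a\cup\beta}V$ then $(\overline M)~\lambda x\,x\to^{=*}_{\ell\cup\beta}\Phi(V)$.
   Context: Fix a ring of scalars (elements $\alpha,\beta$). Terms, values and base terms are given by: $M,N,L ::= V \mid (M)~N \mid \alpha.M \mid M+N$ (terms); $U,V,W ::= 0 \mid B \mid \alpha.V \mid V+W$ (values); $B ::= x \mid \lambda x\,M$ (base terms). Terms are taken up to renaming of bound variables; $M[x:=N]$ is capture-avoiding substitution. Below $V$ is a value and $B$ a base term. Rewrite rules: $(\beta_n)$ $(\lambda x\,M)~N\to M[x:=N]$. $(A)$ $(M+N)~L\to (M)~L+(N)~L$; $(\alpha.M)~N\to\alpha.(M)~N$; $(0)~M\to 0$. $(\beta_v)$ $(\lambda x\,M)~B\to M[x:=B]$. $(A_l)$ $(M+N)~V\to(M)~V+(N)~V$; $(\alpha.M)~V\to\alpha.(M)~V$; $(0)~V\to 0$. $(A_r)$ $(B)~(M+N)\to(B)~M+(B)~N$; $(B)~(\alpha.M)\to\alpha.(B)~M$; $(B)~0\to 0$. (Asso) $M+(N+L)\to(M+N)+L$ and $(M+N)+L\to M+(N+L)$. (Com) $M+N\to N+M$. $(F)$ $\alpha.M+\beta.M\to(\alpha+\beta).M$; $\alpha.M+M\to(\alpha+1).M$; $M+M\to(1+1).M$; $\alpha.(\beta.M)\to(\alpha\beta).M$. $(S)$ $\alpha.(M+N)\to\alpha.M+\alpha.N$;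 $1.M\to M$; $0.M\to 0$; $\alpha.0\to 0$; $0+M\to M$. Context rules $(\xi)$: from $M\to M'$ infer $(M)~N\to(M')~N$, $M+N\to M'+N$, $N+M\to N+M'$, $\alpha.M\to\alpha.M'$. Context rule $(\xi_{lin})$: from $M\to M'$ infer $(V)~M\to(V)~M'$ for $V$ a value. Let $L=\mathrm{Asso}\cup\mathrm{Com}\cup F\cup S$. Define: $\to_a$ generated by $A\cup L$ closed under $\xi$; $\to_\ell$ generated by $A_l\cup A_r\cup L$ closed under $\xi,\xi_{lin}$; $\to_{\beta_v}$ generated by $\beta_v$ closed under $\xi,\xi_{lin}$; $\to_{\beta_n}$ generated by $\beta_n$ closed under $\xi$. For a relation $R$, $R^{=}$ is its symmetric closure and $R^{*}$ its reflexive-transitive closure. Set $\to_{\ell\cup\beta}:=\to_\ell\cup\to_{\beta_v}$, $\to^{=}_{\ell\cup\beta}:=(\to_\ell)^{=}\cup\to_{\beta_v}$, $\to_{a\cup\beta}:=\to_a\cup\to_{\beta_n}$, $\to^{=}_{a\cup\beta}:=(\to_a)^{=}\cup\to_{\beta_n}$. First translation (with $f,g,h$ fresh): $\widetilde{x}=\lambda f\,(f)~x$; $\widetilde{0}=0$; $\widetilde{\lambda x\,M}=\lambda f\,(f)~\lambda x\,\widetilde{M}$; $\widetilde{(M)~N}=\lambda f\,(\widetilde M)~\lambda g\,(\widetilde N)~\lambda h\,((g)~h)~f$; $\widetilde{\alpha.M}=\lambda f\,(\alpha.\widetilde M)~f$; $\widetilde{M+N}=\lambda f\,(\widetilde M+\widetilde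 N)~f$; on values $\Psi(x)=x$, $\Psi(0)=0$, $\Psi(\lambda x\,M)=\lambda x\,\widetilde M$, $\Psi(\alpha.V)=\alpha.\Psi(V)$, $\Psi(V+W)=\Psi(V)+\Psi(W)$. Second translation (with $f,g,y$ fresh): $\overline{x}=x$; $\overline{0}=\lambda f\,(0)~f$; $\overline{\lambda x\,M}=\lambda f\,(f)~\lambda x\,\overline M$; $\overline{(M)~N}=\lambda f\,(\overline M)~\lambda g\,((g)~\overline N)~f$; $\overline{\alpha.M}=\lambda f\,(\alpha.\overline M)~f$; $\overline{M+N}=\lambda f\,(\overline M+\overline N)~f$; on values $\Phi(x)=(x)~\lambda y\,y$, $\Phi(0)=0$, $\Phi(\lambda x\,M)=\lambda x\,\overline M$, $\Phi(\alpha.V)=\alpha.\Phi(V)$, $\Phi(V+W)=\Phi(V)+\Phi(W)$. -}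

module Defs where

open import Level using (Level; _⊔_)
open import Data.Nat using (ℕ; zero; suc)
open import Data.Fin using (Fin; zero; suc)
open import Data.Sum using (_⊎_)
open import Algebra.Bundles using (Ring)
open import Relation.Binary.Construct.Closure.ReflexiveTransitive using (Star)

-- Terms are taken up to alpha-renaming: we use well-scoped de Bruijn indices,
-- Term n = terms with at most n free variables; closed terms are Term 0.
module Lang {c ℓ : Level} (R : Ring c ℓ) where

  open Ring R using () renaming
    (Carrier to Scalar; _+_ to _+ˢ_; _*_ to _*ˢ_; 0# to 0ˢ; 1# to 1ˢ)

  infixl 7 _·_
  infixr 6 _•_
  infixl 5 _⊕_

  data Term (n : ℕ) : Set c where
    var : Fin n → Term n
    ƛ   : Term (suc n) → Term n
    _·_ : Term n → Term n → Term n
    _•_ : Scalar → Term n → Term n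
    _⊕_ : Term n → Term n → Term n
    𝟘   : Term n

  data Base {n : ℕ} : Term n → Set c where
    var : (i : Fin n) → Base (var i)
    ƛ   : (M : Term (suc n)) → Base (ƛ M)

  data Value {n : ℕ} : Term n → Set c where
    𝟘   : Value 𝟘
    base : {B : Term n} → Base B → Value B
    _•_ : (α : Scalar) {V : Term n} → Value V → Value (α • V)
    _⊕_ : {V W : Term n} → Value V → Value W → Value (V ⊕ W)

  ext : {n m : ℕ} → (Fin n → Fin m) → Fin (suc n) → Fin (suc m)
  ext ρ zero    = zero
  ext ρ (suc i) = suc (ρ i)

  rename : {n m : ℕ} → (Fin n → Fin m) → Term n → Term m
  rename ρ (var i) = var (ρ i)
  rename ρ (ƛ M)   = ƛ (rename (ext ρ) M)
  rename ρ (M · N) = rename ρ M · rename ρ N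
  rename ρ (α • M) = α • rename ρ M
  rename ρ (M ⊕ N) = rename ρ M ⊕ rename ρ N
  rename ρ 𝟘       = 𝟘

  wk : {n : ℕ} → Term n → Term (suc n)
  wk = rename suc

  exts : {n m : ℕ} → (Fin n → Term m) → Fin (suc n) → Term (suc m)
  exts σ zero    = var zero
  exts σ (suc i) = wk (σ i)

  sub : {n m : ℕ} → (Fin n → Term m) → Term n → Term m
  sub σ (var i) = σ i
  sub σ (ƛ M)   = ƛ (sub (exts σ) M)
  sub σ (M · N) = sub σ M · sub σ N
  sub σ (α • M) = α • sub σ M
  sub σ (M ⊕ N) = sub σ M ⊕ sub σ N
  sub σ 𝟘       = 𝟘

  single : {n : ℕ} → Term n → Fin (suc n) → Term n
  single N zero    = N
  single N (suc i) = var i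

  -- M [ N ]  is  M[x := N]  where x is the variable bound by the enclosing λ
  _[_] : {n : ℕ} → Term (suc n) → Term n → Term n
  M [ N ] = sub (single N) M

  -- rewrite rules (no reduction under λ, so the scope n stays fixed)

  Rel : ℕ → Set (Level.suc c)
  Rel n = Term n → Term n → Set c

  data Lrule {n : ℕ} : Rel n where
    asso₁ : (M N L : Term n) → Lrule (M ⊕ (N ⊕ L)) ((M ⊕ N) ⊕ L)
    asso₂ : (M N L : Term n) → Lrule ((M ⊕ N) ⊕ L) (M ⊕ (N ⊕ L))
    com   : (M N : Term n) → Lrule (M ⊕ N) (N ⊕ M)
    fac₁  : (α β : Scalar) (M : Term n) → Lrule (α • M ⊕ β • M) ((α +ˢ β) • M)
    fac₂  : (α : Scalar) (M : Term n) → Lrule (α • M ⊕ M) ((α +ˢ 1ˢ) • M)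
    fac₃  : (M : Term n) → Lrule (M ⊕ M) ((1ˢ +ˢ 1ˢ) • M)
    fac₄  : (α β : Scalar) (M : Term n) → Lrule (α • (β • M)) ((α *ˢ β) • M)
    sim₁  : (α : Scalar) (M N : Term n) → Lrule (α • (M ⊕ N)) (α • M ⊕ α • N)
    sim₂  : (M : Term n) → Lrule (1ˢ • M) M
    sim₃  : (M : Term n) → Lrule (0ˢ • M) 𝟘
    sim₄  : (α : Scalar) → Lrule (α • 𝟘) 𝟘
    sim₅  : (M : Term n) → Lrule (𝟘 ⊕ M) M

  data Arule {n : ℕ} : Rel n where
    a₁ : (M N L : Term n) → Arule ((M ⊕ N) · L) (M · L ⊕ N · L)
    a₂ : (α : Scalar) (M N : Term n) → Arule ((α • M) · N) (α • (M · N))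
    a₃ : (M : Term n) → Arule (𝟘 · M) 𝟘

  data Alrule {n : ℕ} : Rel n where
    al₁ : (M N V : Term n) → Value V → Alrule ((M ⊕ N) · V) (M · V ⊕ N · V)
    al₂ : (α : Scalar) (M V : Term n) → Value V → Alrule ((α • M) · V) (α • (M · V))
    al₃ : (V : Term n) → Value V → Alrule (𝟘 · V) 𝟘

  data Arrule {n : ℕ} : Rel n where
    ar₁ : (B M N : Term n) → Base B → Arrule (B · (M ⊕ N)) (B · M ⊕ B · N)
    ar₂ : (α : Scalar) (B M : Term n) → Base B → Arrule (B · (α • M)) (α • (B · M))
    ar₃ : (B : Term n) → Base B → Arrule (B · 𝟘) 𝟘

  data βnrule {n : ℕ} : Rel n where
    βn : (M : Term (suc n)) (N : Term n) → βnrule (ƛ M · N) (M [ N ])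

  data βvrule {n : ℕ} : Rel n where
    βv : (M : Term (suc n)) (B : Term n) → Base B → βvrule (ƛ M · B) (M [ B ])

  _∪_ : {n : ℕ} → Rel n → Rel n → Rel n
  (R₁ ∪ R₂) M N = R₁ M N ⊎ R₂ M N

  Sym : {n : ℕ} → Rel n → Rel n
  Sym R₁ M N = R₁ M N ⊎ R₁ N M

  data Ξ {n : ℕ} (R₁ : Rel n) : Rel n where
    base : {M M' : Term n} → R₁ M M' → Ξ R₁ M M'
    appₗ : {M M' : Term n} (N : Term n) → Ξ R₁ M M' → Ξ R₁ (M · N) (M' · N)
    plusₗ : {M M' : Term n} (N : Term n) → Ξ R₁ M M' → Ξ R₁ (M ⊕ N) (M' ⊕ N)
    plusᵣ : {M M' : Term n} (N : Term n) → Ξ R₁ M M' → Ξ R₁ (N ⊕ M) (N ⊕ M')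
    scal : {M M' : Term n} (α : Scalar) → Ξ R₁ M M' → Ξ R₁ (α • M) (α • M')

  data Ξlin {n : ℕ} (R₁ : Rel n) : Rel n where
    base : {M M' : Term n} → R₁ M M' → Ξlin R₁ M M'
    appₗ : {M M' : Term n} (N : Term n) → Ξlin R₁ M M' → Ξlin R₁ (M · N) (M' · N)
    plusₗ : {M M' : Term n} (N : Term n) → Ξlin R₁ M M' → Ξlin R₁ (M ⊕ N) (M' ⊕ N)
    plusᵣ : {M M' : Term n} (N : Term n) → Ξlin R₁ M M' → Ξlin R₁ (N ⊕ M) (N ⊕ M')
    scal : {M M' : Term n} (α : Scalar) → Ξlin R₁ M M' → Ξlin R₁ (α • M) (α • M')
    appᵣ : {M M' V : Term n} → Value V → Ξlin R₁ M M' → Ξlin R₁ (V · M) (V · M')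

  _→a_ : {n : ℕ} → Rel n
  _→a_ = Ξ (Arule ∪ Lrule)

  _→ℓ_ : {n : ℕ} → Rel n
  _→ℓ_ = Ξlin ((Alrule ∪ Arrule) ∪ Lrule)

  _→βv_ : {n : ℕ} → Rel n
  _→βv_ = Ξlin βvrule

  _→βn_ : {n : ℕ} → Rel n
  _→βn_ = Ξ βnrule

  _→ℓβ_ : {n : ℕ} → Rel n
  _→ℓβ_ = _→ℓ_ ∪ _→βv_

  _→⁼ℓβ_ : {n : ℕ} → Rel n
  _→⁼ℓβ_ = Sym _→ℓ_ ∪ _→βv_

  _→aβ_ : {n : ℕ} → Rel n
  _→aβ_ = _→a_ ∪ _→βn_

  _→⁼aβ_ : {n : ℕ} → Rel n
  _→⁼aβ_ = Sym _→a_ ∪ _→βn_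

  _→*ℓβ_ _→⁼*ℓβ_ _→*aβ_ _→⁼*aβ_ : {n : ℕ} → Rel n
  _→*ℓβ_ = Star _→ℓβ_
  _→⁼*ℓβ_ = Star _→⁼ℓβ_
  _→*aβ_ = Star _→aβ_
  _→⁼*aβ_ = Star _→⁼aβ_

  I : {n : ℕ} → Term n
  I = ƛ (var zero)

  -- first translation  M ↦ M̃   (f, g, h fresh: bound by the new λ's)
  tr₁ : {n : ℕ} → Term n → Term n
  tr₁ (var i) = ƛ (var zero · var (suc i))
  tr₁ 𝟘       = 𝟘
  tr₁ (ƛ M)   = ƛ (var zero · wk (ƛ (tr₁ M)))
  tr₁ (M · N) = ƛ (wk (tr₁ M) ·                                  -- λf (M̃) λg (Ñ) λh ((g) h) f
                   ƛ (wk (wk (tr₁ N)) ·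
                      ƛ ((var (suc zero) · var zero) · var (suc (suc zero)))))
  tr₁ (α • M) = ƛ ((α • wk (tr₁ M)) · var zero)
  tr₁ (M ⊕ N) = ƛ ((wk (tr₁ M) ⊕ wk (tr₁ N)) · var zero)

  Ψ : {n : ℕ} (V : Term n) → Value V → Term n
  Ψ .𝟘 𝟘 = 𝟘
  Ψ .(var i) (base (var i)) = var i
  Ψ .(ƛ M) (base (ƛ M)) = ƛ (tr₁ M)
  Ψ .(α • _) (α • v) = α • Ψ _ v
  Ψ .(_ ⊕ _) (v ⊕ w) = Ψ _ v ⊕ Ψ _ w

  -- second translation  M ↦ M̄   (f, g fresh)
  tr₂ : {n : ℕ} → Term n → Term n
  tr₂ (var i) = var i
  tr₂ 𝟘       = ƛ (𝟘 · var zero)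
  tr₂ (ƛ M)   = ƛ (var zero · wk (ƛ (tr₂ M)))
  tr₂ (M · N) = ƛ (wk (tr₂ M) ·                                  -- λf (M̄) λg ((g) N̄) f
                   ƛ ((var zero · wk (wk (tr₂ N))) · var (suc zero)))
  tr₂ (α • M) = ƛ ((α • wk (tr₂ M)) · var zero)
  tr₂ (M ⊕ N) = ƛ ((wk (tr₂ M) ⊕ wk (tr₂ N)) · var zero)

  Φ : {n : ℕ} (V : Term n) → Value V → Term n
  Φ .𝟘 𝟘 = 𝟘
  Φ .(var i) (base (var i)) = var i · I
  Φ .(ƛ M) (base (ƛ M)) = ƛ (tr₂ M)
  Φ .(α • _) (α • v) = α • Φ _ v
  Φ .(_ ⊕ _) (v ⊕ w) = Φ _ v ⊕ Φ _ w

-- Both halves are Plotkin-style simulations through a colon translation.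
-- For a closed term M and a continuation K, colon M K is what the
-- administrative redexes of (tr M) K reduce to: (tr M) K ⇒ colon M K.
-- A source step M → N is then simulated by colon M K ⇒ colon N K: the
-- linearity rules become identities or L-steps because colon commutes with
-- +, α. and 0, and a β-step becomes two target β-steps followed by the
-- administrative reduction of the contractum, using that the translations
-- commute with substitution.  Finally colon V (λx x) ⇒ Ψ V (resp. Φ V).
module Submission where

open import Defs
open import Level using (Level)
open import Algebra.Bundles using (Ring)
open import Data.Nat using (ℕ; zero; suc)
open import Data.Fin using (Fin; zero; suc)
open import Data.Product using (_×_; _,_)
open import Data.Sum using (inj₁; inj₂) renaming (map to ⊎-map)
open import Function using (_∘_)
open import Relation.Binary.PropositionalEquality hiding ([_])
open import Relation.Binary.Construct.Closure.ReflexiveTransitive using (Star; ε; _◅_; _◅◅_; gmap)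

module _ {c ℓ : Level} (R : Ring c ℓ) where
  open Lang R
  open Ring R using () renaming (_+_ to _+ˢ_; _*_ to _*ˢ_; 0# to 0ˢ; 1# to 1ˢ)

  ext-cong : ∀ {n m} {ρ ρ' : Fin n → Fin m} → ρ ≗ ρ' → ext ρ ≗ ext ρ'
  ext-cong h zero    = refl
  ext-cong h (suc i) = cong suc (h i)

  rename-cong : ∀ {n m} {ρ ρ' : Fin n → Fin m} → ρ ≗ ρ' → rename ρ ≗ rename ρ'
  rename-cong h (var i) = cong var (h i)
  rename-cong h (ƛ M)   = cong ƛ (rename-cong (ext-cong h) M)
  rename-cong h (M · N) = cong₂ _·_ (rename-cong h M) (rename-cong h N)
  rename-cong h (α • M) = cong (α •_) (rename-cong h M)
  rename-cong h (M ⊕ N) = cong₂ _⊕_ (rename-cong h M) (rename-cong h N)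
  rename-cong h 𝟘       = refl

  ext-∘ : ∀ {n m k} (ρ : Fin m → Fin k) (ρ' : Fin n → Fin m) → ext ρ ∘ ext ρ' ≗ ext (ρ ∘ ρ')
  ext-∘ ρ ρ' zero    = refl
  ext-∘ ρ ρ' (suc i) = refl

  rename-∘ : ∀ {n m k} (ρ : Fin m → Fin k) (ρ' : Fin n → Fin m) →
             rename ρ ∘ rename ρ' ≗ rename (ρ ∘ ρ')
  rename-∘ ρ ρ' (var i) = refl
  rename-∘ ρ ρ' (ƛ M)   = cong ƛ (trans (rename-∘ (ext ρ) (ext ρ') M) (rename-cong (ext-∘ ρ ρ') M))
  rename-∘ ρ ρ' (M · N) = cong₂ _·_ (rename-∘ ρ ρ' M) (rename-∘ ρ ρ' N)
  rename-∘ ρ ρ' (α • M) = cong (α •_) (rename-∘ ρ ρ' M)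
  rename-∘ ρ ρ' (M ⊕ N) = cong₂ _⊕_ (rename-∘ ρ ρ' M) (rename-∘ ρ ρ' N)
  rename-∘ ρ ρ' 𝟘       = refl

  wk-rename : ∀ {n m} (ρ : Fin n → Fin m) → wk ∘ rename ρ ≗ rename (ext ρ) ∘ wk
  wk-rename ρ M = trans (rename-∘ suc ρ M) (sym (rename-∘ (ext ρ) suc M))

  wk²-rename : ∀ {n m} (ρ : Fin n → Fin m) → wk ∘ wk ∘ rename ρ ≗ rename (ext (ext ρ)) ∘ wk ∘ wk
  wk²-rename ρ M = trans (cong wk (wk-rename ρ M)) (wk-rename (ext ρ) (wk M))

  exts-cong : ∀ {n m} {σ σ' : Fin n → Term m} → σ ≗ σ' → exts σ ≗ exts σ'
  exts-cong h zero    = refl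
  exts-cong h (suc i) = cong wk (h i)

  sub-cong : ∀ {n m} {σ σ' : Fin n → Term m} → σ ≗ σ' → sub σ ≗ sub σ'
  sub-cong h (var i) = h i
  sub-cong h (ƛ M)   = cong ƛ (sub-cong (exts-cong h) M)
  sub-cong h (M · N) = cong₂ _·_ (sub-cong h M) (sub-cong h N)
  sub-cong h (α • M) = cong (α •_) (sub-cong h M)
  sub-cong h (M ⊕ N) = cong₂ _⊕_ (sub-cong h M) (sub-cong h N)
  sub-cong h 𝟘       = refl

  sub-rename : ∀ {n m k} (σ : Fin m → Term k) (ρ : Fin n → Fin m) →
               sub σ ∘ rename ρ ≗ sub (σ ∘ ρ)
  sub-rename σ ρ (var i) = refl
  sub-rename σ ρ (ƛ M)   = cong ƛ (trans (sub-rename (exts σ) (ext ρ) M)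
                                          (sub-cong (λ { zero → refl ; (suc i) → refl }) M))
  sub-rename σ ρ (M · N) = cong₂ _·_ (sub-rename σ ρ M) (sub-rename σ ρ N)
  sub-rename σ ρ (α • M) = cong (α •_) (sub-rename σ ρ M)
  sub-rename σ ρ (M ⊕ N) = cong₂ _⊕_ (sub-rename σ ρ M) (sub-rename σ ρ N)
  sub-rename σ ρ 𝟘       = refl

  rename-sub : ∀ {n m k} (ρ : Fin m → Fin k) (σ : Fin n → Term m) →
               rename ρ ∘ sub σ ≗ sub (rename ρ ∘ σ)
  rename-sub ρ σ (var i) = refl
  rename-sub ρ σ (ƛ M)   = cong ƛ (trans (rename-sub (ext ρ) (exts σ) M) (sub-cong exts-rename M))
    where
    exts-rename : rename (ext ρ) ∘ exts σ ≗ exts (rename ρ ∘ σ)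
    exts-rename zero    = refl
    exts-rename (suc i) = sym (wk-rename ρ (σ i))
  rename-sub ρ σ (M · N) = cong₂ _·_ (rename-sub ρ σ M) (rename-sub ρ σ N)
  rename-sub ρ σ (α • M) = cong (α •_) (rename-sub ρ σ M)
  rename-sub ρ σ (M ⊕ N) = cong₂ _⊕_ (rename-sub ρ σ M) (rename-sub ρ σ N)
  rename-sub ρ σ 𝟘       = refl

  exts-var : ∀ {n} → exts {n} var ≗ var
  exts-var zero    = refl
  exts-var (suc i) = refl

  sub-var : ∀ {n} (M : Term n) → sub var M ≡ M
  sub-var (var i) = refl
  sub-var (ƛ M)   = cong ƛ (trans (sub-cong exts-var M) (sub-var M))
  sub-var (M · N) = cong₂ _·_ (sub-var M) (sub-var N)
  sub-var (α • M) = cong (α •_) (sub-var M)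
  sub-var (M ⊕ N) = cong₂ _⊕_ (sub-var M) (sub-var N)
  sub-var 𝟘       = refl

  sub-exts-wk : ∀ {n m} (σ : Fin n → Term m) → sub (exts σ) ∘ wk ≗ wk ∘ sub σ
  sub-exts-wk σ M = trans (sub-rename (exts σ) suc M) (sym (rename-sub suc σ M))

  sub-exts²-wk² : ∀ {n m} (σ : Fin n → Term m) → sub (exts (exts σ)) ∘ wk ∘ wk ≗ wk ∘ wk ∘ sub σ
  sub-exts²-wk² σ M = trans (sub-exts-wk (exts σ) (wk M)) (cong wk (sub-exts-wk σ M))

  wk-[] : ∀ {n} (N M : Term n) → wk M [ N ] ≡ M
  wk-[] N M = trans (sub-rename (single N) suc M) (sub-var M)

  wk²-[]-exts : ∀ {n} (N M : Term n) → sub (exts (single N)) (wk (wk M)) ≡ wk M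
  wk²-[]-exts N M = trans (sub-exts-wk (single N) (wk M)) (cong wk (wk-[] N M))

  Base-rename : ∀ {n m} (ρ : Fin n → Fin m) {B : Term n} → Base B → Base (rename ρ B)
  Base-rename ρ (var i) = var (ρ i)
  Base-rename ρ (ƛ M)   = ƛ _

  record Compatible {n : ℕ} (_⟶_ : Rel n) : Set c where
    field
      ·ₗ-compat : ∀ {M M'} N → M ⟶ M' → (M · N) ⟶ (M' · N)
      ⊕ₗ-compat : ∀ {M M'} N → M ⟶ M' → (M ⊕ N) ⟶ (M' ⊕ N)
      ⊕ᵣ-compat : ∀ {M M'} N → M ⟶ M' → (N ⊕ M) ⟶ (N ⊕ M')
      •-compat  : ∀ {M M'} α → M ⟶ M' → (α • M) ⟶ (α • M')

    ⊕-compat* : ∀ {M M' N N'} → Star _⟶_ M M' → Star _⟶_ N N' → Star _⟶_ (M ⊕ N) (M' ⊕ N')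
    ⊕-compat* {M' = M'} {N = N} Ms Ns = gmap (_⊕ N) (⊕ₗ-compat N) Ms ◅◅ gmap (M' ⊕_) (⊕ᵣ-compat M') Ns

    •-compat* : ∀ α {M M'} → Star _⟶_ M M' → Star _⟶_ (α • M) (α • M')
    •-compat* α = gmap (α •_) (•-compat α)

  Ξ-compatible : ∀ {n} {R₁ : Rel n} → Compatible (Ξ R₁)
  Ξ-compatible = record { ·ₗ-compat = appₗ ; ⊕ₗ-compat = plusₗ ; ⊕ᵣ-compat = plusᵣ ; •-compat = scal }

  Ξlin-compatible : ∀ {n} {R₁ : Rel n} → Compatible (Ξlin R₁)
  Ξlin-compatible = record { ·ₗ-compat = appₗ ; ⊕ₗ-compat = plusₗ ; ⊕ᵣ-compat = plusᵣ ; •-compat = scal }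

  ∪-compatible : ∀ {n} {R₁ R₂ : Rel n} → Compatible R₁ → Compatible R₂ → Compatible (R₁ ∪ R₂)
  ∪-compatible C₁ C₂ = record
    { ·ₗ-compat = λ N → ⊎-map (C₁.·ₗ-compat N) (C₂.·ₗ-compat N)
    ; ⊕ₗ-compat = λ N → ⊎-map (C₁.⊕ₗ-compat N) (C₂.⊕ₗ-compat N)
    ; ⊕ᵣ-compat = λ N → ⊎-map (C₁.⊕ᵣ-compat N) (C₂.⊕ᵣ-compat N)
    ; •-compat  = λ α → ⊎-map (C₁.•-compat α) (C₂.•-compat α)
    }
    where
    module C₁ = Compatible C₁
    module C₂ = Compatible C₂

  Sym-compatible : ∀ {n} {R₁ : Rel n} → Compatible R₁ → Compatible (Sym R₁)
  Sym-compatible C = record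
    { ·ₗ-compat = λ N → ⊎-map (·ₗ-compat N) (·ₗ-compat N)
    ; ⊕ₗ-compat = λ N → ⊎-map (⊕ₗ-compat N) (⊕ₗ-compat N)
    ; ⊕ᵣ-compat = λ N → ⊎-map (⊕ᵣ-compat N) (⊕ᵣ-compat N)
    ; •-compat  = λ α → ⊎-map (•-compat α) (•-compat α)
    }
    where open Compatible C

  →⁼aβ-compatible : ∀ {n} → Compatible (_→⁼aβ_ {n})
  →⁼aβ-compatible = ∪-compatible (Sym-compatible Ξ-compatible) Ξ-compatible

  →⁼ℓβ-compatible : ∀ {n} → Compatible (_→⁼ℓβ_ {n})
  →⁼ℓβ-compatible = ∪-compatible (Sym-compatible Ξlin-compatible) Ξlin-compatible

  module _ {n m : ℕ} (F : Term n → Term m)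
           (F-⊕ : ∀ M N → F (M ⊕ N) ≡ F M ⊕ F N)
           (F-• : ∀ α M → F (α • M) ≡ α • F M)
           (F-𝟘 : F 𝟘 ≡ 𝟘) where

    Lrule-map : ∀ {M N} → Lrule M N → Lrule (F M) (F N)
    Lrule-map (asso₁ M N L) rewrite F-⊕ M (N ⊕ L) | F-⊕ N L | F-⊕ (M ⊕ N) L | F-⊕ M N = asso₁ _ _ _
    Lrule-map (asso₂ M N L) rewrite F-⊕ M (N ⊕ L) | F-⊕ N L | F-⊕ (M ⊕ N) L | F-⊕ M N = asso₂ _ _ _
    Lrule-map (com M N) rewrite F-⊕ M N | F-⊕ N M = com _ _
    Lrule-map (fac₁ α β M) rewrite F-⊕ (α • M) (β • M) | F-• α M | F-• β M | F-• (α +ˢ β) M = fac₁ _ _ _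
    Lrule-map (fac₂ α M) rewrite F-⊕ (α • M) M | F-• α M | F-• (α +ˢ 1ˢ) M = fac₂ _ _
    Lrule-map (fac₃ M) rewrite F-⊕ M M | F-• (1ˢ +ˢ 1ˢ) M = fac₃ _
    Lrule-map (fac₄ α β M) rewrite F-• α (β • M) | F-• β M | F-• (α *ˢ β) M = fac₄ _ _ _
    Lrule-map (sim₁ α M N)
      rewrite F-• α (M ⊕ N) | F-⊕ M N | F-⊕ (α • M) (α • N) | F-• α M | F-• α N = sim₁ _ _ _
    Lrule-map (sim₂ M) rewrite F-• 1ˢ M = sim₂ _
    Lrule-map (sim₃ M) rewrite F-• 0ˢ M | F-𝟘 = sim₃ _
    Lrule-map (sim₄ α) rewrite F-• α 𝟘 | F-𝟘 = sim₄ _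
    Lrule-map (sim₅ M) rewrite F-⊕ 𝟘 M | F-𝟘 = sim₅ _

  Ψᵇ : ∀ {n} {B : Term n} → Base B → Term n
  Ψᵇ b = Ψ _ (base b)

  tr₁-base : ∀ {n} {B : Term n} (b : Base B) → tr₁ B ≡ ƛ (var zero · wk (Ψᵇ b))
  tr₁-base (var i) = refl
  tr₁-base (ƛ M)   = refl

  tr₁-rename : ∀ {n m} (ρ : Fin n → Fin m) → tr₁ ∘ rename ρ ≗ rename ρ ∘ tr₁
  tr₁-rename ρ (var i) = refl
  tr₁-rename ρ (ƛ M)   = cong (λ X → ƛ (var zero · X))
    (trans (cong (wk ∘ ƛ) (tr₁-rename (ext ρ) M)) (wk-rename ρ (ƛ (tr₁ M))))
  tr₁-rename ρ (M · N) =
    cong₂ (λ X Y → ƛ (X · ƛ (Y · ƛ ((var (suc zero) · var zero) · var (suc (suc zero))))))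
      (trans (cong wk (tr₁-rename ρ M)) (wk-rename ρ (tr₁ M)))
      (trans (cong (wk ∘ wk) (tr₁-rename ρ N)) (wk²-rename ρ (tr₁ N)))
  tr₁-rename ρ (α • M) = cong (λ X → ƛ ((α • X) · var zero))
    (trans (cong wk (tr₁-rename ρ M)) (wk-rename ρ (tr₁ M)))
  tr₁-rename ρ (M ⊕ N) = cong₂ (λ X Y → ƛ ((X ⊕ Y) · var zero))
    (trans (cong wk (tr₁-rename ρ M)) (wk-rename ρ (tr₁ M)))
    (trans (cong wk (tr₁-rename ρ N)) (wk-rename ρ (tr₁ N)))
  tr₁-rename ρ 𝟘       = refl

  Ψᵇ-rename : ∀ {n m} (ρ : Fin n → Fin m) {B : Term n} (b : Base B) →
              Ψᵇ (Base-rename ρ b) ≡ rename ρ (Ψᵇ b)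
  Ψᵇ-rename ρ (var i) = refl
  Ψᵇ-rename ρ (ƛ M)   = cong ƛ (tr₁-rename (ext ρ) M)

  tr₁-sub : ∀ {n m} (σ : Fin n → Term m) (b : ∀ i → Base (σ i)) →
            tr₁ ∘ sub σ ≗ sub (Ψᵇ ∘ b) ∘ tr₁
  tr₁-sub σ b (var i) = tr₁-base (b i)
  tr₁-sub σ b (ƛ M)   = cong (λ X → ƛ (var zero · X))
    (trans (cong (wk ∘ ƛ) (trans (tr₁-sub (exts σ) exts-base M) (sub-cong Ψᵇ-exts (tr₁ M))))
           (sym (sub-exts-wk (Ψᵇ ∘ b) (ƛ (tr₁ M)))))
    where
    exts-base : ∀ i → Base (exts σ i)
    exts-base zero    = var zero
    exts-base (suc i) = Base-rename suc (b i)
    Ψᵇ-exts : Ψᵇ ∘ exts-base ≗ exts (Ψᵇ ∘ b)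
    Ψᵇ-exts zero    = refl
    Ψᵇ-exts (suc i) = Ψᵇ-rename suc (b i)
  tr₁-sub σ b (M · N) =
    cong₂ (λ X Y → ƛ (X · ƛ (Y · ƛ ((var (suc zero) · var zero) · var (suc (suc zero))))))
      (trans (cong wk (tr₁-sub σ b M)) (sym (sub-exts-wk _ (tr₁ M))))
      (trans (cong (wk ∘ wk) (tr₁-sub σ b N)) (sym (sub-exts²-wk² _ (tr₁ N))))
  tr₁-sub σ b (α • M) = cong (λ X → ƛ ((α • X) · var zero))
    (trans (cong wk (tr₁-sub σ b M)) (sym (sub-exts-wk _ (tr₁ M))))
  tr₁-sub σ b (M ⊕ N) = cong₂ (λ X Y → ƛ ((X ⊕ Y) · var zero))
    (trans (cong wk (tr₁-sub σ b M)) (sym (sub-exts-wk _ (tr₁ M))))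
    (trans (cong wk (tr₁-sub σ b N)) (sym (sub-exts-wk _ (tr₁ N))))
  tr₁-sub σ b 𝟘       = refl

  tr₁-[] : ∀ {n} (P : Term (suc n)) {B : Term n} (b : Base B) → tr₁ (P [ B ]) ≡ tr₁ P [ Ψᵇ b ]
  tr₁-[] P {B} b = trans (tr₁-sub (single B) single-base P) (sub-cong Ψᵇ-single (tr₁ P))
    where
    single-base : ∀ i → Base (single B i)
    single-base zero    = b
    single-base (suc i) = var i
    Ψᵇ-single : Ψᵇ ∘ single-base ≗ single (Ψᵇ b)
    Ψᵇ-single zero    = refl
    Ψᵇ-single (suc i) = refl

  tr₂-rename : ∀ {n m} (ρ : Fin n → Fin m) → tr₂ ∘ rename ρ ≗ rename ρ ∘ tr₂
  tr₂-rename ρ (var i) = refl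
  tr₂-rename ρ (ƛ M)   = cong (λ X → ƛ (var zero · X))
    (trans (cong (wk ∘ ƛ) (tr₂-rename (ext ρ) M)) (wk-rename ρ (ƛ (tr₂ M))))
  tr₂-rename ρ (M · N) = cong₂ (λ X Y → ƛ (X · ƛ ((var zero · Y) · var (suc zero))))
    (trans (cong wk (tr₂-rename ρ M)) (wk-rename ρ (tr₂ M)))
    (trans (cong (wk ∘ wk) (tr₂-rename ρ N)) (wk²-rename ρ (tr₂ N)))
  tr₂-rename ρ (α • M) = cong (λ X → ƛ ((α • X) · var zero))
    (trans (cong wk (tr₂-rename ρ M)) (wk-rename ρ (tr₂ M)))
  tr₂-rename ρ (M ⊕ N) = cong₂ (λ X Y → ƛ ((X ⊕ Y) · var zero))
    (trans (cong wk (tr₂-rename ρ M)) (wk-rename ρ (tr₂ M)))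
    (trans (cong wk (tr₂-rename ρ N)) (wk-rename ρ (tr₂ N)))
  tr₂-rename ρ 𝟘       = refl

  tr₂-sub : ∀ {n m} (σ : Fin n → Term m) → tr₂ ∘ sub σ ≗ sub (tr₂ ∘ σ) ∘ tr₂
  tr₂-sub σ (var i) = refl
  tr₂-sub σ (ƛ M)   = cong (λ X → ƛ (var zero · X))
    (trans (cong (wk ∘ ƛ) (trans (tr₂-sub (exts σ) M) (sub-cong tr₂-exts (tr₂ M))))
           (sym (sub-exts-wk (tr₂ ∘ σ) (ƛ (tr₂ M)))))
    where
    tr₂-exts : tr₂ ∘ exts σ ≗ exts (tr₂ ∘ σ)
    tr₂-exts zero    = refl
    tr₂-exts (suc i) = tr₂-rename suc (σ i)
  tr₂-sub σ (M · N) = cong₂ (λ X Y → ƛ (X · ƛ ((var zero · Y) · var (suc zero))))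
    (trans (cong wk (tr₂-sub σ M)) (sym (sub-exts-wk _ (tr₂ M))))
    (trans (cong (wk ∘ wk) (tr₂-sub σ N)) (sym (sub-exts²-wk² _ (tr₂ N))))
  tr₂-sub σ (α • M) = cong (λ X → ƛ ((α • X) · var zero))
    (trans (cong wk (tr₂-sub σ M)) (sym (sub-exts-wk _ (tr₂ M))))
  tr₂-sub σ (M ⊕ N) = cong₂ (λ X Y → ƛ ((X ⊕ Y) · var zero))
    (trans (cong wk (tr₂-sub σ M)) (sym (sub-exts-wk _ (tr₂ M))))
    (trans (cong wk (tr₂-sub σ N)) (sym (sub-exts-wk _ (tr₂ N))))
  tr₂-sub σ 𝟘       = refl

  tr₂-[] : ∀ {n} (P : Term (suc n)) (N : Term n) → tr₂ (P [ N ]) ≡ tr₂ P [ tr₂ N ]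
  tr₂-[] P N = trans (tr₂-sub (single N) P) (sub-cong (λ { zero → refl ; (suc i) → refl }) (tr₂ P))

  tr₂-closed-base : (N : Term 0) → Base (tr₂ N)
  tr₂-closed-base (var ())
  tr₂-closed-base (ƛ M)   = ƛ _
  tr₂-closed-base (M · N) = ƛ _
  tr₂-closed-base (α • M) = ƛ _
  tr₂-closed-base (M ⊕ N) = ƛ _
  tr₂-closed-base 𝟘       = ƛ _

  module FirstTranslation where

    infix 4 _⇒_
    _⇒_ : Rel 0
    _⇒_ = _→⁼*aβ_

    open Compatible (→⁼aβ-compatible {0})

    βn-step : ∀ (P : Term 1) N {Q} → P [ N ] ≡ Q → (ƛ P · N) →⁼aβ Q
    βn-step P N refl = inj₂ (base (βn P N))

    A-step : ∀ {M N : Term 0} → Arule M N → M →⁼aβ N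
    A-step r = inj₁ (inj₁ (base (inj₁ r)))

    L-step : ∀ {M N : Term 0} → Lrule M N → M →⁼aβ N
    L-step r = inj₁ (inj₁ (base (inj₂ r)))

    -- λg (Q̃) λh ((g) h) K  and  λh ((B) h) K
    fun-cont : Term 0 → Term 0 → Term 0
    fun-cont Q K = ƛ (wk (tr₁ Q) · ƛ ((var (suc zero) · var zero) · wk (wk K)))

    arg-cont : Term 0 → Term 0 → Term 0
    arg-cont B K = ƛ ((wk B · var zero) · wk K)

    mutual
      colon : Term 0 → Term 0 → Term 0
      colon (var ()) K
      colon (ƛ P)    K = K · ƛ (tr₁ P)
      colon (M · Q)  K = colon-· M Q K
      colon (α • M)  K = α • colon M K
      colon (M ⊕ N)  K = colon M K ⊕ colon N K
      colon 𝟘        K = 𝟘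

      colon-· : Term 0 → Term 0 → Term 0 → Term 0
      colon-· (var ()) Q K
      colon-· (ƛ P)    Q K = colon Q (arg-cont (ƛ (tr₁ P)) K)
      colon-· (M · N)  Q K = colon-· M N (fun-cont Q K)
      colon-· (α • M)  Q K = α • colon-· M Q K
      colon-· (M ⊕ N)  Q K = colon-· M Q K ⊕ colon-· N Q K
      colon-· 𝟘        Q K = 𝟘

    mutual
      tr₁-⇒-colon : ∀ M K → tr₁ M · K ⇒ colon M K
      tr₁-⇒-colon (var ()) K
      tr₁-⇒-colon 𝟘 K = A-step (a₃ K) ◅ ε
      tr₁-⇒-colon (ƛ P) K = βn-step _ K (cong (K ·_) (wk-[] K (ƛ (tr₁ P)))) ◅ ε
      tr₁-⇒-colon (M · Q) K =
        βn-step _ K (cong₂ (λ X Y → X · ƛ (Y · ƛ ((var (suc zero) · var zero) · wk (wk K))))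
                           (wk-[] K (tr₁ M)) (wk²-[]-exts K (tr₁ Q)))
        ◅ tr₁-⇒-colon M (fun-cont Q K) ◅◅ colon-fun-cont M Q K
      tr₁-⇒-colon (α • M) K =
        βn-step _ K (cong (λ X → (α • X) · K) (wk-[] K (tr₁ M)))
        ◅ A-step (a₂ α (tr₁ M) K) ◅ •-compat* α (tr₁-⇒-colon M K)
      tr₁-⇒-colon (M ⊕ N) K =
        βn-step _ K (cong₂ (λ X Y → (X ⊕ Y) · K) (wk-[] K (tr₁ M)) (wk-[] K (tr₁ N)))
        ◅ A-step (a₁ (tr₁ M) (tr₁ N) K) ◅ ⊕-compat* (tr₁-⇒-colon M K) (tr₁-⇒-colon N K)

      colon-fun-cont : ∀ M Q K → colon M (fun-cont Q K) ⇒ colon-· M Q K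
      colon-fun-cont (var ()) Q K
      colon-fun-cont (ƛ P) Q K =
        βn-step _ _ (cong₂ (λ X Y → X · ƛ ((wk (ƛ (tr₁ P)) · var zero) · Y))
                           (wk-[] _ (tr₁ Q)) (wk²-[]-exts _ K))
        ◅ tr₁-⇒-colon Q (arg-cont (ƛ (tr₁ P)) K)
      colon-fun-cont (M · N) Q K = ε
      colon-fun-cont (α • M) Q K = •-compat* α (colon-fun-cont M Q K)
      colon-fun-cont (M ⊕ N) Q K = ⊕-compat* (colon-fun-cont M Q K) (colon-fun-cont N Q K)
      colon-fun-cont 𝟘 Q K = ε

    module ContextLift {R₁ : Rel 0}
        (colon-step   : ∀ {M N} → R₁ M N → ∀ K → colon M K ⇒ colon N K)
        (colon-·-step : ∀ {M N} → R₁ M N → ∀ Q K → colon-· M Q K ⇒ colon-· N Q K) where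
      mutual
        colon-Ξlin : ∀ {M N} → Ξlin R₁ M N → ∀ K → colon M K ⇒ colon N K
        colon-Ξlin (base r)    K = colon-step r K
        colon-Ξlin (appₗ Q s)  K = colon-·-Ξlin s Q K
        colon-Ξlin (plusₗ N s) K = ⊕-compat* (colon-Ξlin s K) ε
        colon-Ξlin (plusᵣ N s) K = ⊕-compat* ε (colon-Ξlin s K)
        colon-Ξlin (scal α s)  K = •-compat* α (colon-Ξlin s K)
        colon-Ξlin (appᵣ v s)  K = colon-·-value-Ξlin v s K

        colon-·-Ξlin : ∀ {M N} → Ξlin R₁ M N → ∀ Q K → colon-· M Q K ⇒ colon-· N Q K
        colon-·-Ξlin (base r)    Q K = colon-·-step r Q K
        colon-·-Ξlin (appₗ N s)  Q K = colon-·-Ξlin s N (fun-cont Q K)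
        colon-·-Ξlin (plusₗ N s) Q K = ⊕-compat* (colon-·-Ξlin s Q K) ε
        colon-·-Ξlin (plusᵣ N s) Q K = ⊕-compat* ε (colon-·-Ξlin s Q K)
        colon-·-Ξlin (scal α s)  Q K = •-compat* α (colon-·-Ξlin s Q K)
        colon-·-Ξlin (appᵣ v s)  Q K = colon-·-value-Ξlin v s (fun-cont Q K)

        colon-·-value-Ξlin : ∀ {V M N} → Value V → Ξlin R₁ M N → ∀ K → colon-· V M K ⇒ colon-· V N K
        colon-·-value-Ξlin 𝟘                s K = ε
        colon-·-value-Ξlin (base (var ()))  s K
        colon-·-value-Ξlin (base (ƛ P))     s K = colon-Ξlin s (arg-cont (ƛ (tr₁ P)) K)
        colon-·-value-Ξlin (α • v)          s K = •-compat* α (colon-·-value-Ξlin v s K)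
        colon-·-value-Ξlin (v ⊕ w)          s K =
          ⊕-compat* (colon-·-value-Ξlin v s K) (colon-·-value-Ξlin w s K)

    -- In function position colon distributes over ⊕, α. and 0, so an A-rule
    -- relates two terms with the same colon translation.
    A-colon : ∀ {M N} → (Alrule ∪ Arrule) M N → ∀ K → colon M K ≡ colon N K
    A-colon (inj₁ (al₁ _ _ _ _))        K = refl
    A-colon (inj₁ (al₂ _ _ _ _))        K = refl
    A-colon (inj₁ (al₃ _ _))            K = refl
    A-colon (inj₂ (ar₁ _ _ _ (var ()))) K
    A-colon (inj₂ (ar₁ _ _ _ (ƛ _)))    K = refl
    A-colon (inj₂ (ar₂ _ _ _ (var ()))) K
    A-colon (inj₂ (ar₂ _ _ _ (ƛ _)))    K = refl
    A-colon (inj₂ (ar₃ _ (var ())))     K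
    A-colon (inj₂ (ar₃ _ (ƛ _)))        K = refl

    A-colon-· : ∀ {M N} → (Alrule ∪ Arrule) M N → ∀ Q K → colon-· M Q K ≡ colon-· N Q K
    A-colon-· (inj₁ (al₁ _ _ _ _))        Q K = refl
    A-colon-· (inj₁ (al₂ _ _ _ _))        Q K = refl
    A-colon-· (inj₁ (al₃ _ _))            Q K = refl
    A-colon-· (inj₂ (ar₁ _ _ _ (var ()))) Q K
    A-colon-· (inj₂ (ar₁ _ _ _ (ƛ _)))    Q K = refl
    A-colon-· (inj₂ (ar₂ _ _ _ (var ()))) Q K
    A-colon-· (inj₂ (ar₂ _ _ _ (ƛ _)))    Q K = refl
    A-colon-· (inj₂ (ar₃ _ (var ())))     Q K
    A-colon-· (inj₂ (ar₃ _ (ƛ _)))        Q K = refl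

    ℓ-colon : ∀ {M N} → ((Alrule ∪ Arrule) ∪ Lrule) M N → ∀ K → colon M K ⇒ colon N K
    ℓ-colon (inj₁ r) K rewrite A-colon r K = ε
    ℓ-colon (inj₂ l) K = L-step (Lrule-map (λ M → colon M K) (λ _ _ → refl) (λ _ _ → refl) refl l) ◅ ε

    ℓ-colon-· : ∀ {M N} → ((Alrule ∪ Arrule) ∪ Lrule) M N → ∀ Q K → colon-· M Q K ⇒ colon-· N Q K
    ℓ-colon-· (inj₁ r) Q K rewrite A-colon-· r Q K = ε
    ℓ-colon-· (inj₂ l) Q K =
      L-step (Lrule-map (λ M → colon-· M Q K) (λ _ _ → refl) (λ _ _ → refl) refl l) ◅ ε

    βv-colon : ∀ {M N} → βvrule M N → ∀ K → colon M K ⇒ colon N K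
    βv-colon (βv P _ (var ())) K
    βv-colon (βv P _ (ƛ Q)) K =
      βn-step _ _ (cong₂ (λ X Y → (X · ƛ (tr₁ Q)) · Y) (wk-[] _ (ƛ (tr₁ P))) (wk-[] _ K))
      ◅ ·ₗ-compat K (βn-step (tr₁ P) (ƛ (tr₁ Q)) (sym (tr₁-[] P (ƛ Q))))
      ◅ tr₁-⇒-colon (P [ ƛ Q ]) K

    βv-colon-· : ∀ {M N} → βvrule M N → ∀ Q K → colon-· M Q K ⇒ colon-· N Q K
    βv-colon-· r@(βv P B _) Q K = βv-colon r (fun-cont Q K) ◅◅ colon-fun-cont (P [ B ]) Q K

    colon-step : ∀ {M N} → M →ℓβ N → ∀ K → colon M K ⇒ colon N K
    colon-step (inj₁ s) = ContextLift.colon-Ξlin ℓ-colon ℓ-colon-· s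
    colon-step (inj₂ s) = ContextLift.colon-Ξlin βv-colon βv-colon-· s

    colon-steps : ∀ {M N} → M →*ℓβ N → ∀ K → colon M K ⇒ colon N K
    colon-steps ε        K = ε
    colon-steps (s ◅ ss) K = colon-step s K ◅◅ colon-steps ss K

    colon-I-value : ∀ V (v : Value V) → colon V I ⇒ Ψ V v
    colon-I-value _ 𝟘               = ε
    colon-I-value _ (base (var ()))
    colon-I-value _ (base (ƛ P))    = βn-step (var zero) (ƛ (tr₁ P)) refl ◅ ε
    colon-I-value _ (α • v)         = •-compat* α (colon-I-value _ v)
    colon-I-value _ (v ⊕ w)         = ⊕-compat* (colon-I-value _ v) (colon-I-value _ w)

    simulation : ∀ M V (v : Value V) → M →*ℓβ V → tr₁ M · I ⇒ Ψ V v
    simulation M V v ss = tr₁-⇒-colon M I ◅◅ colon-steps ss I ◅◅ colon-I-value V v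

  module SecondTranslation where

    infix 4 _⇒_
    _⇒_ : Rel 0
    _⇒_ = _→⁼*ℓβ_

    open Compatible (→⁼ℓβ-compatible {0})

    βv-step : ∀ (P : Term 1) {B} → Base B → ∀ {Q} → P [ B ] ≡ Q → (ƛ P · B) →⁼ℓβ Q
    βv-step P b refl = inj₂ (base (βv P _ b))

    Al-step : ∀ {M N : Term 0} → Alrule M N → M →⁼ℓβ N
    Al-step r = inj₁ (inj₁ (base (inj₁ (inj₁ r))))

    L-step : ∀ {M N : Term 0} → Lrule M N → M →⁼ℓβ N
    L-step r = inj₁ (inj₁ (base (inj₂ r)))

    fun-cont : Term 0 → Term 0 → Term 0
    fun-cont N K = ƛ ((var zero · wk (tr₂ N)) · wk K)

    colon : Term 0 → Term 0 → Term 0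
    colon (var ()) K
    colon (ƛ P)    K = K · ƛ (tr₂ P)
    colon (M · N)  K = colon M (fun-cont N K)
    colon (α • M)  K = α • colon M K
    colon (M ⊕ N)  K = colon M K ⊕ colon N K
    colon 𝟘        K = 𝟘

    tr₂-⇒-colon : ∀ M {K} → Base K → tr₂ M · K ⇒ colon M K
    tr₂-⇒-colon (var ()) b
    tr₂-⇒-colon 𝟘 {K} b = βv-step _ b refl ◅ Al-step (al₃ K (base b)) ◅ ε
    tr₂-⇒-colon (ƛ P) {K} b = βv-step _ b (cong (K ·_) (wk-[] K (ƛ (tr₂ P)))) ◅ ε
    tr₂-⇒-colon (M · N) {K} b =
      βv-step _ b (cong₂ (λ X Y → X · ƛ ((var zero · Y) · wk K))
                         (wk-[] K (tr₂ M)) (wk²-[]-exts K (tr₂ N)))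
      ◅ tr₂-⇒-colon M (ƛ _)
    tr₂-⇒-colon (α • M) {K} b =
      βv-step _ b (cong (λ X → (α • X) · K) (wk-[] K (tr₂ M)))
      ◅ Al-step (al₂ α (tr₂ M) K (base b)) ◅ •-compat* α (tr₂-⇒-colon M b)
    tr₂-⇒-colon (M ⊕ N) {K} b =
      βv-step _ b (cong₂ (λ X Y → (X ⊕ Y) · K) (wk-[] K (tr₂ M)) (wk-[] K (tr₂ N)))
      ◅ Al-step (al₁ (tr₂ M) (tr₂ N) K (base b)) ◅ ⊕-compat* (tr₂-⇒-colon M b) (tr₂-⇒-colon N b)

    colon-Ξ : ∀ {R₁ : Rel 0} → (∀ {M N} → R₁ M N → ∀ {K} → Base K → colon M K ⇒ colon N K) →
              ∀ {M N} → Ξ R₁ M N → ∀ {K} → Base K → colon M K ⇒ colon N K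
    colon-Ξ step (base r)    b = step r b
    colon-Ξ step (appₗ N s)  b = colon-Ξ step s (ƛ _)
    colon-Ξ step (plusₗ N s) b = ⊕-compat* (colon-Ξ step s b) ε
    colon-Ξ step (plusᵣ N s) b = ⊕-compat* ε (colon-Ξ step s b)
    colon-Ξ step (scal α s)  b = •-compat* α (colon-Ξ step s b)

    -- As for the first translation, A-steps leave the colon translation unchanged.
    a-colon : ∀ {M N} → (Arule ∪ Lrule) M N → ∀ {K} → Base K → colon M K ⇒ colon N K
    a-colon (inj₁ (a₁ _ _ _)) b = ε
    a-colon (inj₁ (a₂ _ _ _)) b = ε
    a-colon (inj₁ (a₃ _))     b = ε
    a-colon (inj₂ l) {K} b =
      L-step (Lrule-map (λ M → colon M K) (λ _ _ → refl) (λ _ _ → refl) refl l) ◅ ε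

    βn-colon : ∀ {M N} → βnrule M N → ∀ {K} → Base K → colon M K ⇒ colon N K
    βn-colon (βn P N) {K} b =
      βv-step _ (ƛ (tr₂ P)) (cong₂ (λ X Y → (ƛ (tr₂ P) · X) · Y) (wk-[] _ (tr₂ N)) (wk-[] _ K))
      ◅ ·ₗ-compat K (βv-step (tr₂ P) (tr₂-closed-base N) (sym (tr₂-[] P N)))
      ◅ tr₂-⇒-colon (P [ N ]) b

    colon-step : ∀ {M N} → M →aβ N → ∀ {K} → Base K → colon M K ⇒ colon N K
    colon-step (inj₁ s) = colon-Ξ a-colon s
    colon-step (inj₂ s) = colon-Ξ βn-colon s

    colon-steps : ∀ {M N} → M →*aβ N → ∀ {K} → Base K → colon M K ⇒ colon N K
    colon-steps ε        b = ε
    colon-steps (s ◅ ss) b = colon-step s b ◅◅ colon-steps ss b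

    colon-I-value : ∀ V (v : Value V) → colon V I ⇒ Φ V v
    colon-I-value _ 𝟘               = ε
    colon-I-value _ (base (var ()))
    colon-I-value _ (base (ƛ P))    = βv-step (var zero) (ƛ (tr₂ P)) refl ◅ ε
    colon-I-value _ (α • v)         = •-compat* α (colon-I-value _ v)
    colon-I-value _ (v ⊕ w)         = ⊕-compat* (colon-I-value _ v) (colon-I-value _ w)

    simulation : ∀ M V (v : Value V) → M →*aβ V → tr₂ M · I ⇒ Φ V v
    simulation M V v ss = tr₂-⇒-colon M (ƛ _) ◅◅ colon-steps ss (ƛ _) ◅◅ colon-I-value V v

theorem10 : {c ℓ : Level} (R : Ring c ℓ) → let open Lang R in
    (M V : Term 0) (v : Value V) →
      (M →*ℓβ V → (tr₁ M · I) →⁼*aβ Ψ V v)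
      × (M →*aβ V → (tr₂ M · I) →⁼*ℓβ Φ V v)
theorem10 R M V v = FirstTranslation.simulation R M V v , SecondTranslation.simulation R M V v
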